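{- Let $m,n\ge1$, $s_1,\dots,s_m\in\mathbb{N}$ with $s_1+\cdots+s_m=n$, and let $R(W)$ be the set of words $w=w_1\cdots w_n$ that are rearrangements of the multiset $W=\{1^{s_1},2^{s_2},\dots,m^{s_m}\}$. Let $S\subseteq[n]$ and $T\subseteq[m]$, and let $(\lambda(A;w),\lambda(\bar A;w))$ be any one of the pairs $(\alpha(S;w),\alpha([n]\setminus S;w))$, $(\beta(S;w),\beta([n]\setminus S;w))$, $(\gamma(T;w),\gamma([m]\setminus T;w))$, $(\delta(T;w),\delta([m]\setminus T;w))$. Then $$\sum_{w\in R(W)}p^{\lambda(A;w)}q^{\lambda(\bar A;w)}=\sum_{w\in R(W)}p^{\mathrm{inv}(w)}q^{\mathrm{coinv}(w)}=\begin{bmatrix}n\\ s_1,\dots,s_m\end{bmatrix}_{p,q}.$$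
   Context: For a word $w=w_1\cdots w_n$ on $[m]$, a pair $(w_i,w_j)$ with $i<j$ is an inversion if $w_i>w_j$ and a co-inversion if $w_i<w_j$; $\mathrm{inv}(w)$ and $\mathrm{coinv}(w)$ are their numbers. For $S\subseteq[n]$ with complement $\bar S$ and $T\subseteq[m]$ with complement $\bar T$ define: $\alpha(S;w)=\#\{(w_i,w_j)\text{ co-inversion}: n+1-j\in S\}+\#\{(w_i,w_j)\text{ inversion}: n+1-j\notin S\}$; $\beta(S;w)=\#\{(w_i,w_j)\text{ co-inversion}: n+1-i\in S\}+\#\{(w_i,w_j)\text{ inversion}: n+1-i\notin S\}$; $\gamma(T;w)=\#\{(w_i,w_j)\text{ co-inversion}: w_i\in T\}+\#\{(w_i,w_j)\text{ inversion}: w_j\notin T\}$; $\delta(T;w)=\#\{(w_i,w_j)\text{ co-inversion}: w_j\in T\}+\#\{(w_i,w_j)\text{ inversion}: w_i\notin T\}$; and the complementary statistics are obtained by replacing $S$ by $\bar S$ or $T$ by $\bar T$. The $p,q$-integers are $[r]_{p,q}=(p^r-q^r)/(p-q)$, $[r]_{p,q}!=\prod_{i=1}^r[i]_{p,q}$, and $\begin{bmatrix}n\\ s_1,\dots,s_m\end{bmatrix}_{p,q}=\frac{[n]_{p,q}!}{[s_1]_{p,q}!\cdots[s_m]_{p,q}!}$. -}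

module Defs where

open import Level using (0ℓ)
open import Data.Bool using (Bool; true; false; _∧_; _∨_; not; if_then_else_)
open import Data.Nat using (ℕ; zero; suc; _<ᵇ_)
open import Data.Fin using (Fin; toℕ; opposite; _≟_)
open import Data.Fin.Subset using (Subset; ∁; inside)
open import Data.List using (List; []; _∷_; map; concatMap; filter; allFin)
open import Data.Nat.ListAction using (sum)
open import Data.Vec using (Vec; []; _∷_; lookup; tabulate; count)
import Data.Vec.Properties as VP
import Data.Nat as N
open import Algebra.Bundles using (CommutativeSemiring)
open import Relation.Binary.PropositionalEquality using (_≡_)

-- Letter k ∈ [m] is encoded as Fin m value k-1 (order preserved);
-- position i ∈ [n] is encoded as Fin n value i-1.
-- Under this encoding n+1-j (1-based) corresponds to  opposite j  (0-based).

allWords : (m n : ℕ) → List (Vec (Fin m) n)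
allWords m zero    = [] ∷ []
allWords m (suc n) = concatMap (λ a → map (a ∷_) (allWords m n)) (allFin m)

content : ∀ {m n} → Vec (Fin m) n → Vec ℕ m
content w = tabulate (λ k → count (_≟ k) w)

R : ∀ {m} (n : ℕ) → Vec ℕ m → List (Vec (Fin m) n)
R {m} n s = filter (λ w → VP.≡-dec N._≟_ (content w) s) (allWords m n)

_∈ᵇ_ : ∀ {k} → Fin k → Subset k → Bool
i ∈ᵇ S = lookup S i

pairCount : ∀ {n} → (Fin n → Fin n → Bool) → ℕ
pairCount {n} P =
  sum (map (λ i → sum (map (λ j → if (toℕ i <ᵇ toℕ j) ∧ P i j then 1 else 0)
                           (allFin n)))
           (allFin n))

module _ {m n : ℕ} (w : Vec (Fin m) n) where
  isCo isInv : Fin n → Fin n → Bool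
  isCo  i j = toℕ (lookup w i) <ᵇ toℕ (lookup w j)
  isInv i j = toℕ (lookup w j) <ᵇ toℕ (lookup w i)

  inv coinv : ℕ
  inv   = pairCount isInv
  coinv = pairCount isCo

  α β : Subset n → ℕ
  α S = pairCount (λ i j → (isCo i j ∧ (opposite j ∈ᵇ S))
                         ∨ (isInv i j ∧ not (opposite j ∈ᵇ S)))
  β S = pairCount (λ i j → (isCo i j ∧ (opposite i ∈ᵇ S))
                         ∨ (isInv i j ∧ not (opposite i ∈ᵇ S)))

  γ δ : Subset m → ℕ
  γ T = pairCount (λ i j → (isCo i j ∧ (lookup w i ∈ᵇ T))
                         ∨ (isInv i j ∧ not (lookup w j ∈ᵇ T)))
  δ T = pairCount (λ i j → (isCo i j ∧ (lookup w j ∈ᵇ T))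
                         ∨ (isInv i j ∧ not (lookup w i ∈ᵇ T)))

data StatChoice (n m : ℕ) : Set where
  α-choice β-choice : Subset n → StatChoice n m
  γ-choice δ-choice : Subset m → StatChoice n m

statA statĀ : ∀ {n m} → StatChoice n m → Vec (Fin m) n → ℕ
statA (α-choice S) w = α w S
statA (β-choice S) w = β w S
statA (γ-choice T) w = γ w T
statA (δ-choice T) w = δ w T
statĀ (α-choice S) w = α w (∁ S)
statĀ (β-choice S) w = β w (∁ S)
statĀ (γ-choice T) w = γ w (∁ T)
statĀ (δ-choice T) w = δ w (∁ T)

-- p,q-analogues, evaluated in an arbitrary commutative semiring.
-- [r]_{p,q} = (p^r - q^r)/(p - q) is written as the polynomial it equals,
-- Σ_{i=0}^{r-1} p^i q^{r-1-i}.
module PQ (Rg : CommutativeSemiring 0ℓ 0ℓ) where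
  open CommutativeSemiring Rg

  pow : Carrier → ℕ → Carrier
  pow x zero    = 1#
  pow x (suc k) = x * pow x k

  pqInt : Carrier → Carrier → ℕ → Carrier
  pqInt p q zero    = 0#
  pqInt p q (suc r) = pow p r + q * pqInt p q r

  pqFact : Carrier → Carrier → ℕ → Carrier
  pqFact p q zero    = 1#
  pqFact p q (suc r) = pqFact p q r * pqInt p q (suc r)

  pqFactProd : ∀ {m} → Carrier → Carrier → Vec ℕ m → Carrier
  pqFactProd p q []       = 1#
  pqFactProd p q (s ∷ ss) = pqFact p q s * pqFactProd p q ss

  genSum : ∀ {A : Set} → Carrier → Carrier → (A → ℕ) → (A → ℕ) → List A → Carrier
  genSum p q f g []       = 0#
  genSum p q f g (w ∷ ws) = pow p (f w) * pow q (g w) + genSum p q f g ws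

module Submission where

-- Write GF(s; f, g) for Σ_{w of content s} p^{f w} q^{g w}, evaluated in any commutative
-- semiring.  The multinomial coefficient is defined as a product of p,q-binomials, so
-- multinomial s · ∏ [s_k]! = [n]! follows from the binomial case.  We show that every
-- pair of statistics in the theorem has GF = multinomial:
--  * γ is generalised to letterStat t for an arbitrary predicate t on letters, β and α
--    to earlierStat h and laterStat h for a predicate h on positions.  Removing the
--    first letter a (for α the last letter) removes exactly the pairs "counted t a"
--    for a suitable t, and their number depends only on the content of the rest.
--  * So GF satisfies GF(s) = Σ_a [s_a > 0] p^{…} q^{…} GF(s − e_a) (induction on n),
--    a recurrence which the multinomial also satisfies (induction on the alphabet,
--    using both Pascal rules for the p,q-binomial).
--  * inv and coinv are the letter statistics of constant predicates, and δ becomes a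
--    letter statistic after reflecting the alphabet k ↦ m + 1 − k; that reflection also
--    swaps inv and coinv, which shows that the multinomial is invariant under reversing s.

open import Defs
open import Level using (0ℓ)
open import Algebra.Bundles using (CommutativeSemiring)
open import Data.Bool using (Bool; true; false; _∧_; _∨_; not; if_then_else_)
open import Data.Nat using (ℕ; zero; suc; _≤_)
open import Data.Fin using (Fin; toℕ; fromℕ; inject₁; opposite; _≟_)
  renaming (zero to fz; suc to fs)
open import Data.Product using (_×_; _,_; proj₁; proj₂)
open import Data.Vec using (Vec; []; _∷_; lookup; count; _∷ʳ_; sum; _[_]%=_; _[_]≔_)
import Data.Vec.Properties as VP
open import Function using (_∘_; id)
open import Relation.Binary.PropositionalEquality using (_≡_)

module Combinatorics where

  open import Data.Nat using (_+_; _<ᵇ_)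
  import Data.Nat as ℕ
  import Data.Nat.Properties as ℕP
  import Data.Nat.ListAction as ListNat
  open import Data.Fin.Properties using (toℕ-inject₁; opposite-involutive)
  open import Data.Fin.Subset using (Subset; ∁)
  import Data.Fin.Permutation as Perm
  open import Data.List using (map; allFin; tabulate)
  open import Data.List.Properties using (map-tabulate)
  open import Data.Bool.Properties using (not-involutive; ∨-comm; ∨-identityʳ; ∧-zeroʳ; ∧-identityʳ)
  open import Relation.Binary.PropositionalEquality
  open import Relation.Nullary using (Dec; yes; no; does)
  open import Relation.Nullary.Decidable using (dec-true; dec-false)
  import Algebra.Properties.CommutativeMonoid.Sum as MonoidSum
  import Algebra.Properties.CommutativeSemigroup as CommSemigroupProps

  module ℕΣ = MonoidSum ℕP.+-0-commutativeMonoid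
  open ℕΣ using () renaming (sum to Σℕ)
  module ℕCS = CommSemigroupProps ℕP.+-commutativeSemigroup

  listSum-allFin : ∀ {n} (h : Fin n → ℕ) → ListNat.sum (map h (allFin n)) ≡ Σℕ h
  listSum-allFin {zero}  h = refl
  listSum-allFin {suc n} h = cong (h fz +_) (begin
    ListNat.sum (map h (tabulate fs))       ≡⟨ cong ListNat.sum (map-tabulate fs h) ⟩
    ListNat.sum (tabulate (h ∘ fs))         ≡⟨ cong ListNat.sum (map-tabulate id (h ∘ fs)) ⟨
    ListNat.sum (map (h ∘ fs) (allFin n))   ≡⟨ listSum-allFin (h ∘ fs) ⟩
    Σℕ (h ∘ fs)                             ∎)
    where open ≡-Reasoning

  ind : Bool → ℕ
  ind b = if b then 1 else 0

  pairCount≡ΣΣ : ∀ {n} (P : Fin n → Fin n → Bool) →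
    pairCount P ≡ Σℕ (λ i → Σℕ (λ j → ind ((toℕ i <ᵇ toℕ j) ∧ P i j)))
  pairCount≡ΣΣ {n} P = trans (listSum-allFin row) (ℕΣ.sum-cong-≗ (listSum-allFin ∘ entry))
    where
    entry : Fin n → Fin n → ℕ
    entry i j = ind ((toℕ i <ᵇ toℕ j) ∧ P i j)
    row : Fin n → ℕ
    row i = ListNat.sum (map (entry i) (allFin n))

  pairCount-cong : ∀ {n} {P P′ : Fin n → Fin n → Bool} → (∀ i j → P i j ≡ P′ i j) →
    pairCount P ≡ pairCount P′
  pairCount-cong {P = P} {P′} e = begin
    pairCount P                                                   ≡⟨ pairCount≡ΣΣ P ⟩
    Σℕ (λ i → Σℕ (λ j → ind ((toℕ i <ᵇ toℕ j) ∧ P i j)))          ≡⟨ ℕΣ.sum-cong-≗ (λ i → ℕΣ.sum-cong-≗ (λ j →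
                                                                       cong (λ b → ind ((toℕ i <ᵇ toℕ j) ∧ b)) (e i j))) ⟩
    Σℕ (λ i → Σℕ (λ j → ind ((toℕ i <ᵇ toℕ j) ∧ P′ i j)))         ≡⟨ pairCount≡ΣΣ P′ ⟨
    pairCount P′                                                  ∎
    where open ≡-Reasoning

  pairCount-first : ∀ {n} (P : Fin (suc n) → Fin (suc n) → Bool) →
    pairCount P ≡ Σℕ (λ j → ind (P fz (fs j))) + pairCount (λ i j → P (fs i) (fs j))
  pairCount-first P = trans (pairCount≡ΣΣ P)
    (cong (Σℕ (λ j → ind (P fz (fs j))) +_) (sym (pairCount≡ΣΣ (λ i j → P (fs i) (fs j)))))

  inject₁-before-last : ∀ {n} (i : Fin n) → (toℕ (inject₁ i) <ᵇ toℕ (fromℕ n)) ≡ true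
  inject₁-before-last fz     = refl
  inject₁-before-last (fs i) = inject₁-before-last i

  last-before-none : ∀ {n} (j : Fin (suc n)) → (toℕ (fromℕ n) <ᵇ toℕ j) ≡ false
  last-before-none {zero}  fz     = refl
  last-before-none {suc n} fz     = refl
  last-before-none {suc n} (fs j) = last-before-none j

  pairCount-last : ∀ {n} (P : Fin (suc n) → Fin (suc n) → Bool) →
    pairCount P ≡ pairCount (λ i j → P (inject₁ i) (inject₁ j)) + Σℕ (λ i → ind (P (inject₁ i) (fromℕ n)))
  pairCount-last {n} P = begin
    pairCount P                                     ≡⟨ pairCount≡ΣΣ P ⟩
    Σℕ row                                          ≡⟨ ℕΣ.sum-init-last row ⟩
    Σℕ (row ∘ inject₁) + row (fromℕ n)              ≡⟨ cong₂ _+_ (ℕΣ.sum-cong-≗ split-row) last-row-empty ⟩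
    Σℕ (λ i → inner i + lastColumn i) + 0           ≡⟨ ℕP.+-identityʳ _ ⟩
    Σℕ (λ i → inner i + lastColumn i)               ≡⟨ ℕΣ.∑-distrib-+ inner lastColumn ⟩
    Σℕ inner + Σℕ lastColumn                        ≡⟨ cong (_+ Σℕ lastColumn) (pairCount≡ΣΣ (λ i j → P (inject₁ i) (inject₁ j))) ⟨
    pairCount (λ i j → P (inject₁ i) (inject₁ j)) + Σℕ lastColumn ∎
    where
    open ≡-Reasoning
    entry : Fin (suc n) → Fin (suc n) → ℕ
    entry i j = ind ((toℕ i <ᵇ toℕ j) ∧ P i j)
    row : Fin (suc n) → ℕ
    row i = Σℕ (entry i)
    lastColumn : Fin n → ℕ
    lastColumn i = ind (P (inject₁ i) (fromℕ n))
    inner : Fin n → ℕ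
    inner i = Σℕ (λ j → ind ((toℕ i <ᵇ toℕ j) ∧ P (inject₁ i) (inject₁ j)))
    split-row : ∀ i → row (inject₁ i) ≡ inner i + lastColumn i
    split-row i = trans (ℕΣ.sum-init-last (entry (inject₁ i))) (cong₂ _+_
      (ℕΣ.sum-cong-≗ (λ j → cong (λ b → ind (b ∧ P (inject₁ i) (inject₁ j)))
        (cong₂ _<ᵇ_ (toℕ-inject₁ i) (toℕ-inject₁ j))))
      (cong (λ b → ind (b ∧ P (inject₁ i) (fromℕ n))) (inject₁-before-last i)))
    last-row-empty : row (fromℕ n) ≡ 0
    last-row-empty = trans (ℕΣ.sum-cong-≗ (λ j → cong (λ b → ind (b ∧ P (fromℕ n) j)) (last-before-none j)))
                           (ℕΣ.sum-replicate-zero (suc n))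

  does-cong : ∀ {A B : Set} → (A → B) → (B → A) → (a? : Dec A) (b? : Dec B) → does a? ≡ does b?
  does-cong f g (yes a)  b? = sym (dec-true b? (f a))
  does-cong f g (no ¬a) b? = sym (dec-false b? (¬a ∘ g))

  vec-ext : ∀ {A : Set} {m} {u v : Vec A m} → (∀ k → lookup u k ≡ lookup v k) → u ≡ v
  vec-ext {u = u} {v} e = trans (sym (VP.tabulate∘lookup u)) (trans (VP.tabulate-cong e) (VP.tabulate∘lookup v))

  increment≡⇔ : ∀ {m} (a : Fin m) (v s : Vec ℕ m) {k} → lookup s a ≡ suc k →
    (v [ a ]%= suc ≡ s → v ≡ s [ a ]≔ k) × (v ≡ s [ a ]≔ k → v [ a ]%= suc ≡ s)
  increment≡⇔ a v s {k} sa≡1+k = to , from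
    where
    to : v [ a ]%= suc ≡ s → v ≡ s [ a ]≔ k
    to refl = begin
      v                           ≡⟨ VP.[]≔-lookup v a ⟨
      v [ a ]≔ lookup v a         ≡⟨ cong (v [ a ]≔_) (ℕP.suc-injective (trans (sym (VP.lookup∘updateAt a v)) sa≡1+k)) ⟩
      v [ a ]≔ k                  ≡⟨ VP.updateAt-updateAt a v ⟨
      (v [ a ]%= suc) [ a ]≔ k    ∎
      where open ≡-Reasoning
    from : v ≡ s [ a ]≔ k → v [ a ]%= suc ≡ s
    from refl = trans (VP.updateAt-updateAt a s) (VP.updateAt-id-local a s (sym sa≡1+k))

  content-∷ : ∀ {m n} (a : Fin m) (w : Vec (Fin m) n) → content (a ∷ w) ≡ content w [ a ]%= suc
  content-∷ a w = vec-ext entry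
    where
    entry : ∀ k → lookup (content (a ∷ w)) k ≡ lookup (content w [ a ]%= suc) k
    entry k rewrite VP.lookup∘tabulate (λ k → count (_≟ k) (a ∷ w)) k with a ≟ k
    ... | yes refl = sym (trans (VP.lookup∘updateAt a (content w)) (cong suc (VP.lookup∘tabulate _ a)))
    ... | no  a≢k = sym (trans (VP.lookup∘updateAt′ k a (a≢k ∘ sym) (content w)) (VP.lookup∘tabulate _ k))

  count-∷ʳ : ∀ {m n} (k : Fin m) (w : Vec (Fin m) n) b → count (_≟ k) (w ∷ʳ b) ≡ count (_≟ k) (b ∷ w)
  count-∷ʳ k []      b = refl
  count-∷ʳ k (x ∷ w) b = trans (cong (step x) (count-∷ʳ k w b)) (commute (does (x ≟ k)) (does (b ≟ k)))
    where
    step : Fin _ → ℕ → ℕ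
    step x = if does (x ≟ k) then suc else id
    commute : ∀ c d → (if c then suc else id) ((if d then suc else id) (count (_≟ k) w))
                    ≡ (if d then suc else id) ((if c then suc else id) (count (_≟ k) w))
    commute false d     = refl
    commute true  false = refl
    commute true  true  = refl

  content-∷ʳ : ∀ {m n} (w : Vec (Fin m) n) b → content (w ∷ʳ b) ≡ content (b ∷ w)
  content-∷ʳ w b = VP.tabulate-cong (λ k → count-∷ʳ k w b)

  hasContent : ∀ {m n} → Vec (Fin m) n → Vec ℕ m → Bool
  hasContent w s = does (VP.≡-dec ℕ._≟_ (content w) s)

  hasContent⇒ : ∀ {m n} (w : Vec (Fin m) n) s → hasContent w s ≡ true → content w ≡ s
  hasContent⇒ w s h with VP.≡-dec ℕ._≟_ (content w) s
  ... | yes e = e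

  hasContent-∷-absent : ∀ {m n} (a : Fin m) (w : Vec (Fin m) n) s → lookup s a ≡ 0 → hasContent (a ∷ w) s ≡ false
  hasContent-∷-absent a w s sa≡0 = dec-false (VP.≡-dec ℕ._≟_ (content (a ∷ w)) s) λ e →
    ℕP.1+n≢0 (trans (sym (VP.lookup∘updateAt a (content w))) (trans (cong (λ v → lookup v a) (trans (sym (content-∷ a w)) e)) sa≡0))

  hasContent-∷ : ∀ {m n} (a : Fin m) (w : Vec (Fin m) n) s {k} → lookup s a ≡ suc k →
    hasContent (a ∷ w) s ≡ hasContent w (s [ a ]≔ k)
  hasContent-∷ a w s sa≡1+k = does-cong
    (λ e → proj₁ (increment≡⇔ a (content w) s sa≡1+k) (trans (sym (content-∷ a w)) e))
    (λ e → trans (content-∷ a w) (proj₂ (increment≡⇔ a (content w) s sa≡1+k) e))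
    (VP.≡-dec ℕ._≟_ _ s) (VP.≡-dec ℕ._≟_ _ _)

  hasContent-∷ʳ : ∀ {m n} (w : Vec (Fin m) n) b s → hasContent (w ∷ʳ b) s ≡ hasContent (b ∷ w) s
  hasContent-∷ʳ w b s = cong (λ c → does (VP.≡-dec ℕ._≟_ c s)) (content-∷ʳ w b)

  sum≡0⇒lookup≡0 : ∀ {m} (s : Vec ℕ m) a → sum s ≡ 0 → lookup s a ≡ 0
  sum≡0⇒lookup≡0 (x ∷ s) fz     e = ℕP.m+n≡0⇒m≡0 x e
  sum≡0⇒lookup≡0 (x ∷ s) (fs a) e = sum≡0⇒lookup≡0 s a (ℕP.m+n≡0⇒n≡0 x e)

  hasContent-[] : ∀ {m} (s : Vec ℕ m) → sum s ≡ 0 → hasContent [] s ≡ true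
  hasContent-[] s e = dec-true (VP.≡-dec ℕ._≟_ (content []) s)
    (vec-ext λ k → trans (VP.lookup∘tabulate _ k) (sym (sum≡0⇒lookup≡0 s k e)))

  sum-[]≔ : ∀ {m} (s : Vec ℕ m) a {k} → lookup s a ≡ suc k → sum s ≡ suc (sum (s [ a ]≔ k))
  sum-[]≔ (x ∷ s) fz     e = cong (_+ sum s) e
  sum-[]≔ (x ∷ s) (fs a) e = trans (cong (x +_) (sum-[]≔ s a e)) (ℕP.+-suc x _)

  -- weightedSum P s = Σ_{k : P k} s_k, the number of letters satisfying P in any
  -- word of content s.
  weightedSum : ∀ {m} → (Fin m → Bool) → Vec ℕ m → ℕ
  weightedSum P []      = 0
  weightedSum P (x ∷ s) = (if P fz then x else 0) + weightedSum (P ∘ fs) s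

  weightedSum-increment : ∀ {m} (P : Fin m → Bool) a (s : Vec ℕ m) →
    weightedSum P (s [ a ]%= suc) ≡ ind (P a) + weightedSum P s
  weightedSum-increment P fz (x ∷ s) with P fz
  ... | true  = refl
  ... | false = refl
  weightedSum-increment P (fs a) (x ∷ s) =
    trans (cong ((if P fz then x else 0) +_) (weightedSum-increment (P ∘ fs) a s))
          (ℕCS.x∙yz≈y∙xz (if P fz then x else 0) (ind (P (fs a))) (weightedSum (P ∘ fs) s))

  weightedSum-zeros : ∀ {m} (P : Fin m → Bool) → weightedSum P (Data.Vec.tabulate {n = m} (λ _ → 0)) ≡ 0
  weightedSum-zeros {zero}  P = refl
  weightedSum-zeros {suc m} P with P fz
  ... | true  = weightedSum-zeros (P ∘ fs)
  ... | false = weightedSum-zeros (P ∘ fs)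

  weightedSum-cong : ∀ {m} {P P′ : Fin m → Bool} → (∀ k → P k ≡ P′ k) → ∀ s → weightedSum P s ≡ weightedSum P′ s
  weightedSum-cong e []      = refl
  weightedSum-cong e (x ∷ s) = cong₂ (λ b r → (if b then x else 0) + r) (e fz) (weightedSum-cong (e ∘ fs) s)

  weightedSum-const : ∀ {m} c (s : Vec ℕ m) → weightedSum (λ _ → c) s ≡ (if c then sum s else 0)
  weightedSum-const true  []      = refl
  weightedSum-const false []      = refl
  weightedSum-const true  (x ∷ s) = cong (x +_) (weightedSum-const true s)
  weightedSum-const false (x ∷ s) = weightedSum-const false s

  countLetters : ∀ {m n} → (Fin m → Bool) → Vec (Fin m) n → ℕ
  countLetters P w = Σℕ (λ j → ind (P (lookup w j)))

  countLetters≡weightedSum : ∀ {m n} (P : Fin m → Bool) (w : Vec (Fin m) n) →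
    countLetters P w ≡ weightedSum P (content w)
  countLetters≡weightedSum P []      = sym (weightedSum-zeros P)
  countLetters≡weightedSum P (a ∷ w) = begin
    ind (P a) + countLetters P w                 ≡⟨ cong (ind (P a) +_) (countLetters≡weightedSum P w) ⟩
    ind (P a) + weightedSum P (content w)        ≡⟨ weightedSum-increment P a (content w) ⟨
    weightedSum P (content w [ a ]%= suc)        ≡⟨ cong (weightedSum P) (content-∷ a w) ⟨
    weightedSum P (content (a ∷ w))              ∎
    where open ≡-Reasoning

  lookup-∷ʳ-inject₁ : ∀ {A : Set} {n} (w : Vec A n) b i → lookup (w ∷ʳ b) (inject₁ i) ≡ lookup w i
  lookup-∷ʳ-inject₁ (x ∷ w) b fz     = refl
  lookup-∷ʳ-inject₁ (x ∷ w) b (fs i) = lookup-∷ʳ-inject₁ w b i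

  lookup-∷ʳ-last : ∀ {A : Set} {n} (w : Vec A n) b → lookup (w ∷ʳ b) (fromℕ n) ≡ b
  lookup-∷ʳ-last []      b = refl
  lookup-∷ʳ-last (x ∷ w) b = lookup-∷ʳ-last w b

  -- The statistics γ, β and α with the subset replaced by an arbitrary predicate:
  -- on letters (γ), on the earlier position of a pair (β) or on the later one (α).
  letterPairs : ∀ {m n} → (Fin m → Bool) → Vec (Fin m) n → Fin n → Fin n → Bool
  letterPairs t w i j = (isCo w i j ∧ t (lookup w i)) ∨ (isInv w i j ∧ not (t (lookup w j)))

  earlierPairs laterPairs : ∀ {m n} → (Fin n → Bool) → Vec (Fin m) n → Fin n → Fin n → Bool
  earlierPairs h w i j = (isCo w i j ∧ h i) ∨ (isInv w i j ∧ not (h i))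
  laterPairs   h w i j = (isCo w i j ∧ h j) ∨ (isInv w i j ∧ not (h j))

  letterStat : ∀ {m n} → (Fin m → Bool) → Vec (Fin m) n → ℕ
  letterStat t w = pairCount (letterPairs t w)

  earlierStat laterStat : ∀ {m n} → (Fin n → Bool) → Vec (Fin m) n → ℕ
  earlierStat h w = pairCount (earlierPairs h w)
  laterStat   h w = pairCount (laterPairs h w)

  -- The boolean identity behind re-reading a pair from the other end.
  swap-∨ : ∀ u u′ c d → (u ∧ c) ∨ (u′ ∧ d) ≡ (u′ ∧ d) ∨ (u ∧ not (not c))
  swap-∨ u u′ c d rewrite not-involutive c = ∨-comm (u ∧ c) (u′ ∧ d)

  -- Whether a pair of letters a (earlier) and k (later) counts for letterStat t.
  counted : ∀ {m} → (Fin m → Bool) → Fin m → Fin m → Bool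
  counted t a k = ((toℕ a <ᵇ toℕ k) ∧ t a) ∨ ((toℕ k <ᵇ toℕ a) ∧ not (t k))

  -- Every letter is larger than the smallest one fz, so a pair (fz, k) counts exactly when t fz holds.
  weightedSum-counted-smallest : ∀ {m} (t : Fin (suc m) → Bool) k (s : Vec ℕ m) →
    weightedSum (counted t fz) (k ∷ s) ≡ (if t fz then sum s else 0)
  weightedSum-counted-smallest t k s = trans (weightedSum-cong (λ _ → ∨-identityʳ (t fz)) s) (weightedSum-const (t fz) s)

  letterStat-cong : ∀ {m n} {t t′ : Fin m → Bool} → (∀ k → t k ≡ t′ k) → (w : Vec (Fin m) n) → letterStat t w ≡ letterStat t′ w
  letterStat-cong e w = pairCount-cong λ i j →
    cong₂ (λ b c → (isCo w i j ∧ b) ∨ (isInv w i j ∧ not c)) (e (lookup w i)) (e (lookup w j))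

  earlierStat-cong : ∀ {m n} {h h′ : Fin n → Bool} → (∀ i → h i ≡ h′ i) → (w : Vec (Fin m) n) →
    earlierStat h w ≡ earlierStat h′ w
  earlierStat-cong e w = pairCount-cong λ i j → cong (λ b → (isCo w i j ∧ b) ∨ (isInv w i j ∧ not b)) (e i)

  laterStat-cong : ∀ {m n} {h h′ : Fin n → Bool} → (∀ i → h i ≡ h′ i) → (w : Vec (Fin m) n) →
    laterStat h w ≡ laterStat h′ w
  laterStat-cong   e w = pairCount-cong λ i j → cong (λ b → (isCo w i j ∧ b) ∨ (isInv w i j ∧ not b)) (e j)

  lookup-∁ : ∀ {k} (S : Subset k) i → lookup (∁ S) i ≡ not (lookup S i)
  lookup-∁ S i = VP.lookup-map i not S

  letterStat-∷ : ∀ {m n} (t : Fin m → Bool) a (w : Vec (Fin m) n) →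
    letterStat t (a ∷ w) ≡ countLetters (counted t a) w + letterStat t w
  letterStat-∷ t a w = pairCount-first (letterPairs t (a ∷ w))

  earlierStat-∷ : ∀ {m n} (h : Fin (suc n) → Bool) a (w : Vec (Fin m) n) →
    earlierStat h (a ∷ w) ≡ countLetters (counted (λ _ → h fz) a) w + earlierStat (h ∘ fs) w
  earlierStat-∷ h a w = pairCount-first (earlierPairs h (a ∷ w))

  -- Removing the last letter b removes the pairs (k, b); these are counted as if b
  -- came first, with the constant predicate "not h(last)".
  laterStat-∷ʳ : ∀ {m n} (h : Fin (suc n) → Bool) b (w : Vec (Fin m) n) →
    laterStat h (w ∷ʳ b) ≡ countLetters (counted (λ _ → not (h (fromℕ n))) b) w + laterStat (h ∘ inject₁) w
  laterStat-∷ʳ {n = n} h b w = begin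
    laterStat h (w ∷ʳ b)                                   ≡⟨ pairCount-last (laterPairs h v) ⟩
    pairCount (λ i j → laterPairs h v (inject₁ i) (inject₁ j)) + Σℕ (λ i → ind (laterPairs h v (inject₁ i) (fromℕ n)))
                                                           ≡⟨ cong₂ _+_ (pairCount-cong inner-pairs) (ℕΣ.sum-cong-≗ (cong ind ∘ last-pairs)) ⟩
    laterStat (h ∘ inject₁) w + countLetters (counted (λ _ → not x) b) w
                                                           ≡⟨ ℕP.+-comm (laterStat (h ∘ inject₁) w) _ ⟩
    countLetters (counted (λ _ → not x) b) w + laterStat (h ∘ inject₁) w ∎
    where
    open ≡-Reasoning
    v : Vec _ (suc n)
    v = w ∷ʳ b
    x : Bool
    x = h (fromℕ n)
    inner-pairs : ∀ i j → laterPairs h v (inject₁ i) (inject₁ j) ≡ laterPairs (h ∘ inject₁) w i j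
    inner-pairs i j = cong₂ (λ c d → ((toℕ c <ᵇ toℕ d) ∧ h (inject₁ j)) ∨ ((toℕ d <ᵇ toℕ c) ∧ not (h (inject₁ j))))
                            (lookup-∷ʳ-inject₁ w b i) (lookup-∷ʳ-inject₁ w b j)
    last-pairs : ∀ i → laterPairs h v (inject₁ i) (fromℕ n) ≡ counted (λ _ → not x) b (lookup w i)
    last-pairs i = trans (cong₂ (λ c d → ((toℕ c <ᵇ toℕ d) ∧ x) ∨ ((toℕ d <ᵇ toℕ c) ∧ not x))
                                (lookup-∷ʳ-inject₁ w b i) (lookup-∷ʳ-last w b))
                         (swap-∨ (toℕ (lookup w i) <ᵇ toℕ b) (toℕ b <ᵇ toℕ (lookup w i)) x (not x))

  inv≡letterStat : ∀ {m n} (w : Vec (Fin m) n) → inv w ≡ letterStat (λ _ → false) w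
  inv≡letterStat w = pairCount-cong λ i j → sym (cong₂ _∨_ (∧-zeroʳ (isCo w i j)) (∧-identityʳ (isInv w i j)))

  coinv≡letterStat : ∀ {m n} (w : Vec (Fin m) n) → coinv w ≡ letterStat (λ _ → true) w
  coinv≡letterStat w = pairCount-cong λ i j →
    sym (trans (cong₂ _∨_ (∧-identityʳ (isCo w i j)) (∧-zeroʳ (isInv w i j))) (∨-identityʳ (isCo w i j)))

  reflectWord : ∀ {m n} → Vec (Fin m) n → Vec (Fin m) n
  reflectWord = Data.Vec.map opposite

  opposite-<ᵇ : ∀ {m} (a b : Fin m) → (toℕ (opposite a) <ᵇ toℕ (opposite b)) ≡ (toℕ b <ᵇ toℕ a)
  opposite-<ᵇ {suc m} fz     fz     = last-before-none (fromℕ m)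
  opposite-<ᵇ {suc m} fz     (fs b) = last-before-none (inject₁ (opposite b))
  opposite-<ᵇ {suc m} (fs a) fz     = inject₁-before-last (opposite a)
  opposite-<ᵇ {suc m} (fs a) (fs b) = trans (cong₂ _<ᵇ_ (toℕ-inject₁ (opposite a)) (toℕ-inject₁ (opposite b))) (opposite-<ᵇ a b)

  inv-reflect : ∀ {m n} (v : Vec (Fin m) n) → inv (reflectWord v) ≡ coinv v
  inv-reflect v = pairCount-cong λ i j →
    trans (cong₂ (λ c d → toℕ d <ᵇ toℕ c) (VP.lookup-map i opposite v) (VP.lookup-map j opposite v))
          (opposite-<ᵇ (lookup v j) (lookup v i))

  coinv-reflect : ∀ {m n} (v : Vec (Fin m) n) → coinv (reflectWord v) ≡ inv v
  coinv-reflect v = pairCount-cong λ i j →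
    trans (cong₂ (λ c d → toℕ c <ᵇ toℕ d) (VP.lookup-map i opposite v) (VP.lookup-map j opposite v))
          (opposite-<ᵇ (lookup v i) (lookup v j))

  δ-reflect : ∀ {m n} (T : Subset m) (v : Vec (Fin m) n) →
    δ (reflectWord v) T ≡ letterStat (λ k → not (lookup T (opposite k))) v
  δ-reflect {m} {n} T v = pairCount-cong pairs
    where
    w : Vec (Fin m) n
    w = reflectWord v
    pairs : ∀ i j → ((isCo w i j ∧ (lookup w j ∈ᵇ T)) ∨ (isInv w i j ∧ not (lookup w i ∈ᵇ T)))
                    ≡ letterPairs (λ k → not (lookup T (opposite k))) v i j
    pairs i j rewrite VP.lookup-map i opposite v | VP.lookup-map j opposite v
                    | opposite-<ᵇ (lookup v i) (lookup v j) | opposite-<ᵇ (lookup v j) (lookup v i)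
      = swap-∨ (toℕ (lookup v j) <ᵇ toℕ (lookup v i)) (toℕ (lookup v i) <ᵇ toℕ (lookup v j))
               (lookup T (opposite (lookup v j))) (not (lookup T (opposite (lookup v i))))

  reflect : ∀ {m} → Vec ℕ m → Vec ℕ m
  reflect s = Data.Vec.tabulate (lookup s ∘ opposite)

  reflect-involutive : ∀ {m} (s : Vec ℕ m) → reflect (reflect s) ≡ s
  reflect-involutive s = vec-ext λ k →
    trans (VP.lookup∘tabulate _ k) (trans (VP.lookup∘tabulate _ (opposite k)) (cong (lookup s) (opposite-involutive k)))

  sum-reflect : ∀ {m} (s : Vec ℕ m) → sum (reflect s) ≡ sum s
  sum-reflect s = begin
    sum (reflect s)              ≡⟨ sum-tabulate (lookup s ∘ opposite) ⟩
    Σℕ (lookup s ∘ opposite)     ≡⟨ ℕΣ.∑-permute (lookup s) Perm.reverse ⟨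
    Σℕ (lookup s)                ≡⟨ sum-tabulate (lookup s) ⟨
    sum (Data.Vec.tabulate (lookup s)) ≡⟨ cong sum (VP.tabulate∘lookup s) ⟩
    sum s                        ∎
    where
    open ≡-Reasoning
    sum-tabulate : ∀ {m} (f : Fin m → ℕ) → sum (Data.Vec.tabulate f) ≡ Σℕ f
    sum-tabulate {zero}  f = refl
    sum-tabulate {suc m} f = cong (f fz +_) (sum-tabulate (f ∘ fs))

  count-reflect : ∀ {m n} (k : Fin m) (v : Vec (Fin m) n) →
    count (_≟ k) (reflectWord v) ≡ count (_≟ opposite k) v
  count-reflect k []      = refl
  count-reflect k (a ∷ v) rewrite count-reflect k v
    | does-cong (λ e → trans (sym (opposite-involutive a)) (cong opposite e))
                (λ e → trans (cong opposite e) (opposite-involutive k)) (opposite a ≟ k) (a ≟ opposite k) = refl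

  content-reflect : ∀ {m n} (v : Vec (Fin m) n) → content (reflectWord v) ≡ reflect (content v)
  content-reflect v = vec-ext λ k → begin
    lookup (content (reflectWord v)) k  ≡⟨ VP.lookup∘tabulate _ k ⟩
    count (_≟ k) (reflectWord v)        ≡⟨ count-reflect k v ⟩
    count (_≟ opposite k) v                       ≡⟨ VP.lookup∘tabulate _ (opposite k) ⟨
    lookup (content v) (opposite k)               ≡⟨ VP.lookup∘tabulate _ k ⟨
    lookup (reflect (content v)) k                ∎
    where open ≡-Reasoning

  hasContent-reflect : ∀ {m n} (v : Vec (Fin m) n) s →
    hasContent (reflectWord v) s ≡ hasContent v (reflect s)
  hasContent-reflect v s = does-cong
    (λ e → trans (sym (reflect-involutive (content v))) (cong reflect (trans (sym (content-reflect v)) e)))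
    (λ e → trans (content-reflect v) (trans (cong reflect e) (reflect-involutive s)))
    (VP.≡-dec ℕ._≟_ _ s) (VP.≡-dec ℕ._≟_ _ _)

module GeneratingFunctions (Rg : CommutativeSemiring 0ℓ 0ℓ) (p q : CommutativeSemiring.Carrier Rg) where

  open CommutativeSemiring Rg hiding (zero)
  open PQ Rg
  open Combinatorics
  open import Data.Nat using () renaming (_+_ to _+ℕ_)
  import Data.Nat as ℕ
  import Data.Nat.Properties as ℕP
  open import Data.List using (List; concatMap) renaming ([] to []ˡ; _∷_ to _∷ˡ_)
  import Data.List as List
  open import Relation.Nullary using (Dec; does)
  import Relation.Binary.PropositionalEquality as ≡
  open import Relation.Binary.Reasoning.Setoid setoid
  open import Algebra.Solver.Ring.NaturalCoefficients.Default Rg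
  import Algebra.Properties.Semiring.Sum as SemiringSum
  import Data.Fin.Permutation as Perm
  open import Data.Fin.Subset using (Subset; ∁)

  module Σ = SemiringSum semiring
  open Σ using () renaming (sum to ∑)

  ∑-zero : ∀ {n} (f : Fin n → Carrier) → (∀ i → f i ≈ 0#) → ∑ f ≈ 0#
  ∑-zero {n} f e = trans (Σ.sum-cong-≋ e) (Σ.sum-replicate-zero n)

  Σwords : ∀ {m} n → (Vec (Fin m) n → Carrier) → Carrier
  Σwords zero    F = F []
  Σwords (suc n) F = ∑ (λ a → Σwords n (λ w → F (a ∷ w)))

  Σwords-cong : ∀ {m} n {F F′ : Vec (Fin m) n → Carrier} → (∀ w → F w ≈ F′ w) → Σwords n F ≈ Σwords n F′
  Σwords-cong zero    e = e []
  Σwords-cong (suc n) e = Σ.sum-cong-≋ (λ a → Σwords-cong n (λ w → e (a ∷ w)))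

  Σwords-zero : ∀ {m} n (F : Vec (Fin m) n → Carrier) → (∀ w → F w ≈ 0#) → Σwords n F ≈ 0#
  Σwords-zero zero    F e = e []
  Σwords-zero (suc n) F e = ∑-zero _ (λ a → Σwords-zero n _ (λ w → e (a ∷ w)))

  Σwords-distribˡ : ∀ {m} n x (F : Vec (Fin m) n → Carrier) → x * Σwords n F ≈ Σwords n (λ w → x * F w)
  Σwords-distribˡ zero    x F = refl
  Σwords-distribˡ (suc n) x F = trans (Σ.*-distribˡ-sum x (λ a → Σwords n (λ w → F (a ∷ w))))
                                      (Σ.sum-cong-≋ (λ a → Σwords-distribˡ n x (λ w → F (a ∷ w))))

  Σwords-∷ʳ : ∀ {m} n (F : Vec (Fin m) (suc n) → Carrier) → Σwords (suc n) F ≈ Σwords n (λ w → ∑ (λ b → F (w ∷ʳ b)))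
  Σwords-∷ʳ zero    F = refl
  Σwords-∷ʳ (suc n) F = Σ.sum-cong-≋ (λ a → Σwords-∷ʳ n (λ w → F (a ∷ w)))

  Σwords-∑ : ∀ {m k} n (H : Vec (Fin m) n → Fin k → Carrier) → Σwords n (λ w → ∑ (H w)) ≈ ∑ (λ b → Σwords n (λ w → H w b))
  Σwords-∑ zero    H = refl
  Σwords-∑ (suc n) H = trans (Σ.sum-cong-≋ (λ a → Σwords-∑ n (λ w → H (a ∷ w)))) (Σ.∑-comm (λ a b → Σwords n (λ w → H (a ∷ w) b)))

  Σwords-reflect : ∀ {m} n (F : Vec (Fin m) n → Carrier) → Σwords n F ≈ Σwords n (λ w → F (reflectWord w))
  Σwords-reflect zero    F = refl
  Σwords-reflect (suc n) F = trans (Σ.sum-cong-≋ (λ a → Σwords-reflect n (λ w → F (a ∷ w))))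
                                   (Σ.∑-permute (λ a → Σwords n (λ w → F (a ∷ reflectWord w))) Perm.reverse)

  listΣ : ∀ {A : Set} → List A → (A → Carrier) → Carrier
  listΣ []ˡ       F = 0#
  listΣ (x ∷ˡ xs) F = F x + listΣ xs F

  listΣ-++ : ∀ {A : Set} (xs ys : List A) F → listΣ (xs List.++ ys) F ≈ listΣ xs F + listΣ ys F
  listΣ-++ []ˡ       ys F = sym (+-identityˡ _)
  listΣ-++ (x ∷ˡ xs) ys F = trans (+-congˡ (listΣ-++ xs ys F)) (sym (+-assoc _ _ _))

  listΣ-map : ∀ {A B : Set} (h : A → B) xs F → listΣ (List.map h xs) F ≈ listΣ xs (F ∘ h)
  listΣ-map h []ˡ       F = refl
  listΣ-map h (x ∷ˡ xs) F = +-congˡ (listΣ-map h xs F)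

  listΣ-concatMap : ∀ {A B : Set} (h : A → List B) xs F → listΣ (concatMap h xs) F ≈ listΣ xs (λ a → listΣ (h a) F)
  listΣ-concatMap h []ˡ       F = refl
  listΣ-concatMap h (x ∷ˡ xs) F = trans (listΣ-++ (h x) (concatMap h xs) F) (+-congˡ (listΣ-concatMap h xs F))

  listΣ-tabulate : ∀ {A : Set} {n} (g : Fin n → A) F → listΣ (List.tabulate g) F ≈ ∑ (F ∘ g)
  listΣ-tabulate {n = zero}  g F = refl
  listΣ-tabulate {n = suc n} g F = +-congˡ (listΣ-tabulate (g ∘ fs) F)

  listΣ-allWords : ∀ {m} n (F : Vec (Fin m) n → Carrier) → listΣ (allWords m n) F ≈ Σwords n F
  listΣ-allWords     zero    F = +-identityʳ _
  listΣ-allWords {m} (suc n) F = begin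
    listΣ (allWords m (suc n)) F                            ≈⟨ listΣ-concatMap (λ a → List.map (a ∷_) (allWords m n)) (List.allFin m) F ⟩
    listΣ (List.allFin m) (λ a → listΣ (List.map (a ∷_) (allWords m n)) F)
                                                            ≈⟨ listΣ-tabulate {n = m} id _ ⟩
    ∑ (λ a → listΣ (List.map (a ∷_) (allWords m n)) F)     ≈⟨ Σ.sum-cong-≋ (λ a →
                                                                 trans (listΣ-map (a ∷_) (allWords m n) F) (listΣ-allWords n (λ w → F (a ∷ w)))) ⟩
    Σwords (suc n) F                                        ∎

  weight : ∀ {A : Set} → (A → ℕ) → (A → ℕ) → A → Carrier
  weight f g w = pow p (f w) * pow q (g w)

  restrict : Bool → Carrier → Carrier
  restrict b x = if b then x else 0#

  genSum-filter : ∀ {A : Set} {P : A → Set} (P? : ∀ x → Dec (P x)) f g xs →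
    genSum p q f g (List.filter P? xs) ≈ listΣ xs (λ w → restrict (does (P? w)) (weight f g w))
  genSum-filter P? f g []ˡ = refl
  genSum-filter P? f g (x ∷ˡ xs) with does (P? x)
  ... | true  = +-congˡ (genSum-filter P? f g xs)
  ... | false = trans (genSum-filter P? f g xs) (sym (+-identityˡ _))

  GF : ∀ {m} n → Vec ℕ m → (Vec (Fin m) n → ℕ) → (Vec (Fin m) n → ℕ) → Carrier
  GF n s f g = Σwords n (λ w → restrict (hasContent w s) (weight f g w))

  genSum≈GF : ∀ {m} n (s : Vec ℕ m) f g → genSum p q f g (R n s) ≈ GF n s f g
  genSum≈GF {m} n s f g = trans (genSum-filter (λ w → VP.≡-dec ℕ._≟_ (content w) s) f g (allWords m n)) (listΣ-allWords n _)

  GF-cong : ∀ {m} n (s : Vec ℕ m) {f g f′ g′} → (∀ w → f w ≡ f′ w) → (∀ w → g w ≡ g′ w) → GF n s f g ≈ GF n s f′ g′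
  GF-cong n s ef eg = Σwords-cong n (λ w → reflexive (≡.cong₂ (λ u v → restrict (hasContent w s) (pow p u * pow q v)) (ef w) (eg w)))

  GF-congʳ : ∀ {m} n (s : Vec ℕ m) f {g g′} → (∀ w → g w ≡ g′ w) → GF n s f g ≈ GF n s f g′
  GF-congʳ n s f eg = GF-cong n s {f} {f′ = f} (λ _ → ≡.refl) eg

  ifPositive : ℕ → (ℕ → Carrier) → Carrier
  ifPositive zero    g = 0#
  ifPositive (suc k) g = g k

  afterRemoving : ∀ {m} → Vec ℕ m → Fin m → (Vec ℕ m → Carrier) → Carrier
  afterRemoving s a h = ifPositive (lookup s a) (λ k → h (s [ a ]≔ k))

  afterRemoving-cong : ∀ {m} (s : Vec ℕ m) a {h h′ : Vec ℕ m → Carrier} →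
    (∀ k → lookup s a ≡ suc k → h (s [ a ]≔ k) ≈ h′ (s [ a ]≔ k)) → afterRemoving s a h ≈ afterRemoving s a h′
  afterRemoving-cong s a e with lookup s a
  ... | zero  = refl
  ... | suc k = e k ≡.refl

  afterRemoving-distribˡ : ∀ {m} (s : Vec ℕ m) a x h → x * afterRemoving s a h ≈ afterRemoving s a (λ s′ → x * h s′)
  afterRemoving-distribˡ s a x h with lookup s a
  ... | zero  = zeroʳ x
  ... | suc k = refl

  afterRemoving-absent : ∀ {m} (s : Vec ℕ m) a h → lookup s a ≡ 0 → afterRemoving s a h ≈ 0#
  afterRemoving-absent s a h sa≡0 rewrite sa≡0 = refl

  Σwords-first-letter : ∀ {m} n (s : Vec ℕ m) a (X : Vec (Fin m) (suc n) → Carrier) →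
    Σwords n (λ w → restrict (hasContent (a ∷ w) s) (X (a ∷ w)))
      ≈ afterRemoving s a (λ s′ → Σwords n (λ w → restrict (hasContent w s′) (X (a ∷ w))))
  Σwords-first-letter n s a X with lookup s a in sa
  ... | zero  = Σwords-zero n _ (λ w → reflexive (≡.cong (λ b → restrict b (X (a ∷ w))) (hasContent-∷-absent a w s sa)))
  ... | suc k = Σwords-cong n (λ w → reflexive (≡.cong (λ b → restrict b (X (a ∷ w))) (hasContent-∷ a w s sa)))

  GF-first : ∀ {m} n (s : Vec ℕ m) f g →
    GF (suc n) s f g ≈ ∑ (λ a → afterRemoving s a (λ s′ → GF n s′ (f ∘ (a ∷_)) (g ∘ (a ∷_))))
  GF-first n s f g = Σ.sum-cong-≋ (λ a → Σwords-first-letter n s a (weight f g))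

  GF-last : ∀ {m} n (s : Vec ℕ m) f g →
    GF (suc n) s f g ≈ ∑ (λ b → afterRemoving s b (λ s′ → GF n s′ (f ∘ (_∷ʳ b)) (g ∘ (_∷ʳ b))))
  GF-last n s f g = begin
    GF (suc n) s f g                                               ≈⟨ Σwords-∷ʳ n (λ v → restrict (hasContent v s) (weight f g v)) ⟩
    Σwords n (λ w → ∑ (λ b → restrict (hasContent (w ∷ʳ b) s) (weight f g (w ∷ʳ b))))
                                                                   ≈⟨ Σwords-cong n (λ w → Σ.sum-cong-≋ (λ b →
                                                                        reflexive (≡.cong (λ c → restrict c (weight f g (w ∷ʳ b))) (hasContent-∷ʳ w b s)))) ⟩
    Σwords n (λ w → ∑ (λ b → restrict (hasContent (b ∷ w) s) (weight f g (w ∷ʳ b))))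
                                                                   ≈⟨ Σwords-∑ n (λ w b → restrict (hasContent (b ∷ w) s) (weight f g (w ∷ʳ b))) ⟩
    ∑ (λ b → Σwords n (λ w → restrict (hasContent (b ∷ w) s) (weight f g (w ∷ʳ b))))
                                                                   ≈⟨ Σ.sum-cong-≋ (λ b → Σwords-first-letter n s b (λ v → weight f g (Data.Vec.tail v ∷ʳ Data.Vec.head v))) ⟩
    ∑ (λ b → afterRemoving s b (λ s′ → GF n s′ (f ∘ (_∷ʳ b)) (g ∘ (_∷ʳ b)))) ∎

  pow-+ : ∀ x a b → pow x (a +ℕ b) ≈ pow x a * pow x b
  pow-+ x zero    b = sym (*-identityˡ _)
  pow-+ x (suc a) b = trans (*-congˡ (pow-+ x a b)) (sym (*-assoc _ _ _))

  pqInt-+ : ∀ a b → pqInt p q (a +ℕ b) ≈ pow p b * pqInt p q a + pow q a * pqInt p q b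
  pqInt-+ zero    b = sym (trans (+-cong (zeroʳ _) (*-identityˡ _)) (+-identityˡ _))
  pqInt-+ (suc a) b = begin
    pow p (a +ℕ b) + q * pqInt p q (a +ℕ b)                               ≈⟨ +-cong (pow-+ p a b) (*-congˡ (pqInt-+ a b)) ⟩
    pow p a * pow p b + q * (pow p b * pqInt p q a + pow q a * pqInt p q b) ≈⟨ solve 6 (λ q pa pb qa ia ib →
                                                                               pa :* pb :+ q :* (pb :* ia :+ qa :* ib) := pb :* (pa :+ q :* ia) :+ q :* qa :* ib)
                                                                             refl q (pow p a) (pow p b) (pow q a) (pqInt p q a) (pqInt p q b) ⟩
    pow p b * pqInt p q (suc a) + pow q (suc a) * pqInt p q b             ∎

  -- binom a b is the p,q-binomial coefficient [a+b choose a]_{p,q}: the generating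
  -- function of p^coinv q^inv over words with a smaller and b larger letters, defined
  -- by the Pascal recurrence on the first letter.
  binom : ℕ → ℕ → Carrier
  binom zero    b       = 1#
  binom (suc a) zero    = 1#
  binom (suc a) (suc b) = pow p (suc b) * binom a (suc b) + pow q (suc a) * binom (suc a) b

  binom-0 : ∀ a → binom a 0 ≈ 1#
  binom-0 zero    = refl
  binom-0 (suc a) = refl

  binom-pascal′ : ∀ a b → binom (suc a) (suc b) ≈ pow q (suc b) * binom a (suc b) + pow p (suc a) * binom (suc a) b
  binom-pascal′ zero zero = +-comm _ _
  binom-pascal′ zero (suc b) = begin
    p * (p * pow p b) * 1# + q * 1# * binom 1 (suc b)                                ≈⟨ +-congˡ (*-congˡ (binom-pascal′ zero b)) ⟩
    p * (p * pow p b) * 1# + q * 1# * (q * pow q b * 1# + p * 1# * binom 1 b)        ≈⟨ solve 5 (λ p q P Q X →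
        p :* (p :* P) :* con 1 :+ q :* con 1 :* (q :* Q :* con 1 :+ p :* con 1 :* X)
     := q :* (q :* Q) :* con 1 :+ p :* con 1 :* (p :* P :* con 1 :+ q :* con 1 :* X)) refl p q (pow p b) (pow q b) (binom 1 b) ⟩
    q * (q * pow q b) * 1# + p * 1# * (p * pow p b * 1# + q * 1# * binom 1 b)        ∎
  binom-pascal′ (suc a) zero = begin
    p * 1# * binom (suc a) 1 + q * (q * pow q a) * 1#                                ≈⟨ +-congʳ (*-congˡ (binom-pascal′ a zero)) ⟩
    p * 1# * (q * 1# * binom a 1 + p * pow p a * 1#) + q * (q * pow q a) * 1#        ≈⟨ solve 5 (λ p q P Q Y →
        p :* con 1 :* (q :* con 1 :* Y :+ p :* P :* con 1) :+ q :* (q :* Q) :* con 1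
     := q :* con 1 :* (p :* con 1 :* Y :+ q :* Q :* con 1) :+ p :* (p :* P) :* con 1) refl p q (pow p a) (pow q a) (binom a 1) ⟩
    q * 1# * (p * 1# * binom a 1 + q * pow q a * 1#) + p * (p * pow p a) * 1#        ∎
  binom-pascal′ (suc a) (suc b) = begin
    pb2 * binom (suc a) (suc (suc b)) + qa2 * binom (suc (suc a)) (suc b)
                                         ≈⟨ +-cong (*-congˡ (binom-pascal′ a (suc b))) (*-congˡ (binom-pascal′ (suc a) b)) ⟩
    pb2 * (qb2 * B₁ + pa1 * B₂) + qa2 * (qb1 * B₂ + pa2 * B₃)
                                         ≈⟨ solve 9 (λ p q pa pb qa qb B₁ B₂ B₃ →
        p :* (p :* pb) :* (q :* (q :* qb) :* B₁ :+ p :* pa :* B₂) :+ q :* (q :* qa) :* (q :* qb :* B₂ :+ p :* (p :* pa) :* B₃)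
     := q :* (q :* qb) :* (p :* (p :* pb) :* B₁ :+ q :* qa :* B₂) :+ p :* (p :* pa) :* (p :* pb :* B₂ :+ q :* (q :* qa) :* B₃))
                                             refl p q (pow p a) (pow p b) (pow q a) (pow q b) B₁ B₂ B₃ ⟩
    qb2 * (pb2 * B₁ + qa1 * B₂) + pa2 * (pb1 * B₂ + qa2 * B₃) ∎
    where
    pb1 pb2 pa1 pa2 qb1 qb2 qa1 qa2 B₁ B₂ B₃ : Carrier
    pb2 = pow p (suc (suc b)); pb1 = pow p (suc b); pa1 = pow p (suc a); pa2 = pow p (suc (suc a))
    qb2 = pow q (suc (suc b)); qb1 = pow q (suc b); qa1 = pow q (suc a); qa2 = pow q (suc (suc a))
    B₁ = binom a (suc (suc b)); B₂ = binom (suc a) (suc b); B₃ = binom (suc (suc a)) b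

  binom-factorials : ∀ a b → binom a b * pqFact p q a * pqFact p q b ≈ pqFact p q (a +ℕ b)
  binom-factorials zero    b    = trans (*-congʳ (*-identityˡ _)) (*-identityˡ _)
  binom-factorials (suc a) zero rewrite ℕP.+-identityʳ a = trans (*-identityʳ _) (*-identityˡ _)
  binom-factorials (suc a) (suc b) = begin
    (PB * B₁ + QA * B₂) * (fa * ia) * (fb * ib)               ≈⟨ solve 8 (λ PB QA B₁ B₂ fa ia fb ib →
                                                                   (PB :* B₁ :+ QA :* B₂) :* (fa :* ia) :* (fb :* ib)
                                                                := PB :* ia :* (B₁ :* fa :* (fb :* ib)) :+ QA :* ib :* (B₂ :* (fa :* ia) :* fb))
                                                                 refl PB QA B₁ B₂ fa ia fb ib ⟩
    PB * ia * (B₁ * fa * (fb * ib)) + QA * ib * (B₂ * (fa * ia) * fb)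
                                                              ≈⟨ +-cong (*-congˡ (binom-factorials a (suc b)))
                                                                        (*-congˡ (trans (binom-factorials (suc a) b) (reflexive (≡.cong (pqFact p q) (≡.sym (ℕP.+-suc a b)))))) ⟩
    PB * ia * F + QA * ib * F                                 ≈⟨ solve 5 (λ PB QA ia ib F → PB :* ia :* F :+ QA :* ib :* F := F :* (PB :* ia :+ QA :* ib))
                                                                   refl PB QA ia ib F ⟩
    F * (PB * ia + QA * ib)                                   ≈⟨ *-congˡ (sym (pqInt-+ (suc a) (suc b))) ⟩
    pqFact p q (suc a +ℕ suc b)                               ∎
    where
    PB QA B₁ B₂ fa ia fb ib F : Carrier
    PB = pow p (suc b); QA = pow q (suc a); B₁ = binom a (suc b); B₂ = binom (suc a) b
    fa = pqFact p q a; ia = pqInt p q (suc a); fb = pqFact p q b; ib = pqInt p q (suc b)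
    F = pqFact p q (a +ℕ suc b)

  multinomial : ∀ {m} → Vec ℕ m → Carrier
  multinomial []      = 1#
  multinomial (x ∷ s) = binom x (sum s) * multinomial s

  multinomial-factorials : ∀ {m} (s : Vec ℕ m) → multinomial s * pqFactProd p q s ≈ pqFact p q (sum s)
  multinomial-factorials []      = *-identityˡ _
  multinomial-factorials (x ∷ s) = begin
    binom x (sum s) * multinomial s * (pqFact p q x * pqFactProd p q s) ≈⟨ solve 4 (λ a b c d → a :* b :* (c :* d) := a :* c :* (b :* d))
                                                                           refl (binom x (sum s)) (multinomial s) (pqFact p q x) (pqFactProd p q s) ⟩
    binom x (sum s) * pqFact p q x * (multinomial s * pqFactProd p q s) ≈⟨ *-congˡ (multinomial-factorials s) ⟩
    binom x (sum s) * pqFact p q x * pqFact p q (sum s)                 ≈⟨ binom-factorials x (sum s) ⟩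
    pqFact p q (x +ℕ sum s)                                             ∎

  1·1·_ : ∀ x → 1# * 1# * x ≈ x
  1·1· x = trans (*-congʳ (*-identityˡ 1#)) (*-identityˡ x)

  -- The weight of K pairs that are all weighted p (c = true) or all weighted q.
  pairsWeight : Bool → ℕ → Carrier
  pairsWeight c K = pow p (if c then K else 0) * pow q (if not c then K else 0)

  -- Both Pascal recurrences in one statement, splitting on whether the first letter
  -- is one of the x smaller or one of the K larger letters.  For c = true a smaller
  -- letter before a larger one weighs p (the defining recurrence); for c = false it
  -- weighs q (binom-pascal′).
  binom-first-letter : ∀ (c : Bool) x K → 0 ℕ.< x +ℕ K →
    ifPositive x (λ k → pairsWeight c K * binom k K) + ifPositive K (λ K′ → pairsWeight (not c) x * binom x K′) ≈ binom x K
  binom-first-letter c     zero    zero    ()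
  binom-first-letter true  zero    (suc K) _ = trans (+-identityˡ _) (1·1· 1#)
  binom-first-letter false zero    (suc K) _ = trans (+-identityˡ _) (1·1· 1#)
  binom-first-letter true  (suc x) zero    _ = trans (+-identityʳ _) (trans (1·1· binom x 0) (binom-0 x))
  binom-first-letter false (suc x) zero    _ = trans (+-identityʳ _) (trans (1·1· binom x 0) (binom-0 x))
  binom-first-letter true  (suc x) (suc K) _ =
    +-cong (*-congʳ (*-identityʳ _)) (*-congʳ (*-identityˡ _))
  binom-first-letter false (suc x) (suc K) _ =
    trans (+-cong (*-congʳ (*-identityˡ _)) (*-congʳ (*-identityʳ _))) (sym (binom-pascal′ x K))

  ifPositive-cong : ∀ x {g g′ : ℕ → Carrier} → (∀ k → g k ≈ g′ k) → ifPositive x g ≈ ifPositive x g′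
  ifPositive-cong zero    e = refl
  ifPositive-cong (suc x) e = e x

  ifPositive-distribʳ : ∀ x g y → ifPositive x g * y ≈ ifPositive x (λ k → g k * y)
  ifPositive-distribʳ zero    g y = zeroˡ y
  ifPositive-distribʳ (suc x) g y = refl

  -- The term of the multinomial recurrence for the first letter a: the pairs (a, k)
  -- with k a later letter weighted as in letterStat t, times the multinomial of the rest.
  removalTerm : ∀ {m} → (Fin m → Bool) → Fin m → Vec ℕ m → Carrier
  removalTerm t a s′ = pow p (weightedSum (counted t a) s′) * pow q (weightedSum (counted (not ∘ t) a) s′) * multinomial s′

  -- If the first letter is the smallest one, it forms a pair with every later letter.
  removalTerm-smallest : ∀ {m} (t : Fin (suc m) → Bool) k (s : Vec ℕ m) →
    removalTerm t fz (k ∷ s) ≈ pairsWeight (t fz) (sum s) * binom k (sum s) * multinomial s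
  removalTerm-smallest t k s = trans (sym (*-assoc _ _ _)) (*-congʳ (*-congʳ (reflexive (≡.cong₂ (λ u v → pow p u * pow q v)
    (weightedSum-counted-smallest t k s) (weightedSum-counted-smallest (not ∘ t) k s)))))

  -- Otherwise its pairs with the x copies of the smallest letter split off, and the
  -- rest is a removal term over the alphabet without the smallest letter.
  removalTerm-larger : ∀ {m} (t : Fin (suc m) → Bool) x (s : Vec ℕ m) b {k K} → lookup s b ≡ suc k → sum s ≡ suc K →
    removalTerm t (fs b) (x ∷ s [ b ]≔ k) ≈ pairsWeight (not (t fz)) x * binom x K * removalTerm (t ∘ fs) b (s [ b ]≔ k)
  removalTerm-larger t x s b {k} {K} sb≡1+k e = begin
    pow p (ex +ℕ w₁) * pow q (ex′ +ℕ w₂) * (binom x (sum s′) * multinomial s′)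
        ≈⟨ *-cong (*-cong (pow-+ p ex w₁) (pow-+ q ex′ w₂)) (*-congʳ (reflexive (≡.cong (binom x) sum-s′))) ⟩
    pow p ex * pow p w₁ * (pow q ex′ * pow q w₂) * (binom x K * multinomial s′)
        ≈⟨ solve 6 (λ a b c d e f → a :* b :* (c :* d) :* (e :* f) := a :* c :* e :* (b :* d :* f)) refl
             (pow p ex) (pow p w₁) (pow q ex′) (pow q w₂) (binom x K) (multinomial s′) ⟩
    pairsWeight (not (t fz)) x * binom x K * removalTerm (t ∘ fs) b s′ ∎
    where
    s′ : Vec ℕ _
    s′ = s [ b ]≔ k
    ex ex′ w₁ w₂ : ℕ
    ex  = if not (t fz) then x else 0
    ex′ = if not (not (t fz)) then x else 0
    w₁  = weightedSum (counted (t ∘ fs) b) s′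
    w₂  = weightedSum (counted (not ∘ t ∘ fs) b) s′
    sum-s′ : sum s′ ≡ K
    sum-s′ = ℕP.suc-injective (≡.trans (≡.sym (sum-[]≔ s b sb≡1+k)) e)

  -- Induction on the alphabet: the smallest
  -- letter is handled by binom-first-letter, the others by the induction hypothesis.
  multinomial-recurrence : ∀ {m} (t : Fin m → Bool) n (s : Vec ℕ m) → sum s ≡ suc n →
    multinomial s ≈ ∑ (λ a → afterRemoving s a (removalTerm t a))
  multinomial-recurrence t n (x ∷ s) x+K≡1+n = sym (begin
    ∑ (λ a → afterRemoving (x ∷ s) a (removalTerm t a))                   ≈⟨ +-cong first-letter (later-letters (sum s) ≡.refl) ⟩
    ifPositive x A * multinomial s + ifPositive (sum s) B * multinomial s ≈⟨ distribʳ _ _ _ ⟨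
    (ifPositive x A + ifPositive (sum s) B) * multinomial s               ≈⟨ *-congʳ (binom-first-letter (t fz) x (sum s) positive) ⟩
    binom x (sum s) * multinomial s                                       ∎)
    where
    positive : 0 ℕ.< x +ℕ sum s
    positive = ≡.subst (0 ℕ.<_) (≡.sym x+K≡1+n) (ℕ.s≤s ℕ.z≤n)
    A B : ℕ → Carrier
    A k  = pairsWeight (t fz) (sum s) * binom k (sum s)
    B K′ = pairsWeight (not (t fz)) x * binom x K′
    first-letter : afterRemoving (x ∷ s) fz (removalTerm t fz) ≈ ifPositive x A * multinomial s
    first-letter = sym (trans (ifPositive-distribʳ x A (multinomial s)) (ifPositive-cong x (λ k → sym (removalTerm-smallest t k s))))
    later-letters : ∀ K → sum s ≡ K →
      ∑ (λ b → afterRemoving (x ∷ s) (fs b) (removalTerm t (fs b))) ≈ ifPositive K B * multinomial s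
    later-letters zero    K≡0   = trans (∑-zero _ λ b → afterRemoving-absent s b (removalTerm t (fs b) ∘ (x ∷_)) (sum≡0⇒lookup≡0 s b K≡0))
                                        (sym (zeroˡ _))
    later-letters (suc K) K≡1+K = begin
      ∑ (λ b → afterRemoving s b (λ s′ → removalTerm t (fs b) (x ∷ s′)))  ≈⟨ Σ.sum-cong-≋ split ⟩
      ∑ (λ b → afterRemoving s b (λ s′ → B K * removalTerm (t ∘ fs) b s′)) ≈⟨ Σ.sum-cong-≋ (λ b → afterRemoving-distribˡ s b (B K) (removalTerm (t ∘ fs) b)) ⟨
      ∑ (λ b → B K * afterRemoving s b (removalTerm (t ∘ fs) b))         ≈⟨ Σ.*-distribˡ-sum (B K) (λ b → afterRemoving s b (removalTerm (t ∘ fs) b)) ⟨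
      B K * ∑ (λ b → afterRemoving s b (removalTerm (t ∘ fs) b))         ≈⟨ *-congˡ (multinomial-recurrence (t ∘ fs) K s K≡1+K) ⟨
      B K * multinomial s                                                ∎
      where
      split : ∀ b → afterRemoving s b (λ s′ → removalTerm t (fs b) (x ∷ s′)) ≈ afterRemoving s b (λ s′ → B K * removalTerm (t ∘ fs) b s′)
      split b = afterRemoving-cong s b {removalTerm t (fs b) ∘ (x ∷_)} {λ s′ → B K * removalTerm (t ∘ fs) b s′}
                  (λ k sb≡1+k → removalTerm-larger t x s b sb≡1+k K≡1+K)

  multinomial-empty : ∀ {m} (s : Vec ℕ m) → sum s ≡ 0 → multinomial s ≈ 1#
  multinomial-empty []      e = refl
  multinomial-empty (x ∷ s) e rewrite ℕP.m+n≡0⇒m≡0 x e = trans (*-identityˡ _) (multinomial-empty s (ℕP.m+n≡0⇒n≡0 x e))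

  GF-empty : ∀ {m} (s : Vec ℕ m) → sum s ≡ 0 → (f g : Vec (Fin m) 0 → ℕ) → f [] ≡ 0 → g [] ≡ 0 → GF 0 s f g ≈ multinomial s
  GF-empty s e f g f≡0 g≡0 rewrite hasContent-[] s e | f≡0 | g≡0 = trans (*-identityˡ 1#) (sym (multinomial-empty s e))

  -- On words of content s the counted letters are fixed, so their weight factors out.
  GF-factor : ∀ {m} n (s : Vec ℕ m) (P Q : Fin m → Bool) {f g f′ g′ : Vec (Fin m) n → ℕ} →
    (∀ w → f w ≡ countLetters P w +ℕ f′ w) → (∀ w → g w ≡ countLetters Q w +ℕ g′ w) →
    GF n s f g ≈ pow p (weightedSum P s) * pow q (weightedSum Q s) * GF n s f′ g′
  GF-factor n s P Q {f} {g} {f′} {g′} ef eg = trans (Σwords-cong n term) (sym (Σwords-distribˡ n C (λ w → restrict (hasContent w s) (weight f′ g′ w))))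
    where
    C : Carrier
    C = pow p (weightedSum P s) * pow q (weightedSum Q s)
    term : ∀ w → restrict (hasContent w s) (weight f g w) ≈ C * restrict (hasContent w s) (weight f′ g′ w)
    term w with hasContent w s in has
    ... | false = sym (zeroʳ C)
    ... | true  = begin
      pow p (f w) * pow q (g w)                                                ≈⟨ reflexive (≡.cong₂ (λ u v → pow p u * pow q v)
                                                                                     (≡.trans (ef w) (≡.cong (_+ℕ f′ w) (counted-fixed P)))
                                                                                     (≡.trans (eg w) (≡.cong (_+ℕ g′ w) (counted-fixed Q)))) ⟩
      pow p (weightedSum P s +ℕ f′ w) * pow q (weightedSum Q s +ℕ g′ w)        ≈⟨ *-cong (pow-+ p (weightedSum P s) (f′ w)) (pow-+ q (weightedSum Q s) (g′ w)) ⟩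
      pow p (weightedSum P s) * pow p (f′ w) * (pow q (weightedSum Q s) * pow q (g′ w))
                                                                               ≈⟨ solve 4 (λ a b c d → a :* b :* (c :* d) := a :* c :* (b :* d)) refl
                                                                                    (pow p (weightedSum P s)) (pow p (f′ w)) (pow q (weightedSum Q s)) (pow q (g′ w)) ⟩
      C * weight f′ g′ w                                                       ∎
      where
      counted-fixed : ∀ P → countLetters P w ≡ weightedSum P s
      counted-fixed P = ≡.trans (countLetters≡weightedSum P w) (≡.cong (weightedSum P) (hasContent⇒ w s has))

  -- The inductive step shared by all statistics: if removing the first (or last)
  -- letter a of a word removes exactly the pairs that letterStat t (resp. not ∘ t)
  -- counts between a and the other letters, and the remaining statistics have the
  -- multinomial as generating function, then so does the original pair.
  GF-step : ∀ {m n} (t : Fin m → Bool) (s : Vec ℕ m) → sum s ≡ suc n →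
    (f g : Fin m → Vec (Fin m) n → ℕ) (f′ g′ : Vec (Fin m) n → ℕ) →
    (∀ a w → f a w ≡ countLetters (counted t a) w +ℕ f′ w) →
    (∀ a w → g a w ≡ countLetters (counted (not ∘ t) a) w +ℕ g′ w) →
    (∀ s′ → sum s′ ≡ n → GF n s′ f′ g′ ≈ multinomial s′) →
    ∑ (λ a → afterRemoving s a (λ s′ → GF n s′ (f a) (g a))) ≈ multinomial s
  GF-step {n = n} t s e f g f′ g′ ef eg hyp = trans (Σ.sum-cong-≋ λ a → afterRemoving-cong s a {λ s′ → GF n s′ (f a) (g a)} {removalTerm t a} (λ k sa≡1+k →
      trans (GF-factor n (s [ a ]≔ k) (counted t a) (counted (not ∘ t) a) (ef a) (eg a))
            (*-congˡ (hyp (s [ a ]≔ k) (ℕP.suc-injective (≡.trans (≡.sym (sum-[]≔ s a sa≡1+k)) e))))))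
    (sym (multinomial-recurrence t n s e))

  letterStat-GF : ∀ {m} n (t : Fin m → Bool) (s : Vec ℕ m) → sum s ≡ n →
    GF n s (letterStat t) (letterStat (not ∘ t)) ≈ multinomial s
  letterStat-GF zero    t s e = GF-empty s e (letterStat t) (letterStat (not ∘ t)) ≡.refl ≡.refl
  letterStat-GF (suc n) t s e = trans (GF-first n s (letterStat t) (letterStat (not ∘ t)))
    (GF-step t s e (λ a → letterStat t ∘ (a ∷_)) (λ a → letterStat (not ∘ t) ∘ (a ∷_)) (letterStat t) (letterStat (not ∘ t))
      (letterStat-∷ t) (letterStat-∷ (not ∘ t)) (λ s′ e′ → letterStat-GF n t s′ e′))

  earlierStat-GF : ∀ {m} n (h : Fin n → Bool) (s : Vec ℕ m) → sum s ≡ n →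
    GF n s (earlierStat h) (earlierStat (not ∘ h)) ≈ multinomial s
  earlierStat-GF zero    h s e = GF-empty s e (earlierStat h) (earlierStat (not ∘ h)) ≡.refl ≡.refl
  earlierStat-GF (suc n) h s e = trans (GF-first n s (earlierStat h) (earlierStat (not ∘ h)))
    (GF-step (λ _ → h fz) s e (λ a → earlierStat h ∘ (a ∷_)) (λ a → earlierStat (not ∘ h) ∘ (a ∷_))
      (earlierStat (h ∘ fs)) (earlierStat (not ∘ h ∘ fs))
      (earlierStat-∷ h) (earlierStat-∷ (not ∘ h)) (λ s′ e′ → earlierStat-GF n (h ∘ fs) s′ e′))

  laterStat-GF : ∀ {m} n (h : Fin n → Bool) (s : Vec ℕ m) → sum s ≡ n →
    GF n s (laterStat h) (laterStat (not ∘ h)) ≈ multinomial s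
  laterStat-GF zero    h s e = GF-empty s e (laterStat h) (laterStat (not ∘ h)) ≡.refl ≡.refl
  laterStat-GF (suc n) h s e = trans (GF-last n s (laterStat h) (laterStat (not ∘ h)))
    (GF-step (λ _ → not (h (fromℕ n))) s e (λ b → laterStat h ∘ (_∷ʳ b)) (λ b → laterStat (not ∘ h) ∘ (_∷ʳ b))
      (laterStat (h ∘ inject₁)) (laterStat (not ∘ h ∘ inject₁))
      (laterStat-∷ʳ h) (laterStat-∷ʳ (not ∘ h)) (λ s′ e′ → laterStat-GF n (h ∘ inject₁) s′ e′))

  GF-reflect : ∀ {m} n (s : Vec ℕ m) f g →
    GF n s f g ≈ GF n (reflect s) (f ∘ reflectWord) (g ∘ reflectWord)
  GF-reflect n s f g = trans (Σwords-reflect n _) (Σwords-cong n λ v →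
    reflexive (≡.cong (λ b → restrict b (weight f g (reflectWord v))) (hasContent-reflect v s)))

  -- The multinomial coefficient is invariant under reversing its arguments:
  -- reflection exchanges inv and coinv, whose generating functions are the multinomial.
  multinomial-reflect : ∀ {m} n (s : Vec ℕ m) → sum s ≡ n → multinomial (reflect s) ≈ multinomial s
  multinomial-reflect n s e = begin
    multinomial (reflect s)                                          ≈⟨ letterStat-GF n (λ _ → true) (reflect s) (≡.trans (sum-reflect s) e) ⟨
    GF n (reflect s) (letterStat (λ _ → true)) (letterStat (λ _ → false)) ≈⟨ GF-cong n (reflect s) coinv≡letterStat inv≡letterStat ⟨
    GF n (reflect s) coinv inv                                       ≈⟨ GF-cong n (reflect s) inv-reflect coinv-reflect ⟨
    GF n (reflect s) (inv ∘ reflectWord) (coinv ∘ reflectWord)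
                                                                     ≈⟨ GF-reflect n s inv coinv ⟨
    GF n s inv coinv                                                 ≈⟨ GF-cong n s inv≡letterStat coinv≡letterStat ⟩
    GF n s (letterStat (λ _ → false)) (letterStat (λ _ → true))      ≈⟨ letterStat-GF n (λ _ → false) s e ⟩
    multinomial s                                                    ∎

  -- δ becomes a letter statistic after reflecting the alphabet.
  δ-GF : ∀ {m} n (T : Subset m) (s : Vec ℕ m) → sum s ≡ n →
    GF n s (λ w → δ w T) (λ w → δ w (∁ T)) ≈ multinomial s
  δ-GF n T s e = begin
    GF n s (λ w → δ w T) (λ w → δ w (∁ T))                  ≈⟨ GF-reflect n s (λ w → δ w T) (λ w → δ w (∁ T)) ⟩
    GF n (reflect s) (λ v → δ (reflectWord v) T) (λ v → δ (reflectWord v) (∁ T))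
                                                            ≈⟨ GF-cong n (reflect s) (δ-reflect T) (λ v → ≡.trans (δ-reflect (∁ T) v)
                                                                 (letterStat-cong (λ k → ≡.cong not (lookup-∁ T (opposite k))) v)) ⟩
    GF n (reflect s) (letterStat t) (letterStat (not ∘ t))  ≈⟨ letterStat-GF n t (reflect s) (≡.trans (sum-reflect s) e) ⟩
    multinomial (reflect s)                                 ≈⟨ multinomial-reflect n s e ⟩
    multinomial s                                           ∎
    where
    t : Fin _ → Bool
    t k = not (lookup T (opposite k))

  statistic-GF : ∀ {m} n (s : Vec ℕ m) → sum s ≡ n → (c : StatChoice n m) →
    GF n s (statA c) (statĀ c) ≈ multinomial s
  statistic-GF n s e (α-choice S) = trans (GF-congʳ n s (statA (α-choice S)) (laterStat-cong (lookup-∁ S ∘ opposite)))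
                                          (laterStat-GF n (lookup S ∘ opposite) s e)
  statistic-GF n s e (β-choice S) = trans (GF-congʳ n s (statA (β-choice S)) (earlierStat-cong (lookup-∁ S ∘ opposite)))
                                          (earlierStat-GF n (lookup S ∘ opposite) s e)
  statistic-GF n s e (γ-choice T) = trans (GF-congʳ n s (statA (γ-choice T)) (letterStat-cong (lookup-∁ T)))
                                          (letterStat-GF n (lookup T) s e)
  statistic-GF n s e (δ-choice T) = δ-GF n T s e

  inv-GF : ∀ {m} n (s : Vec ℕ m) → sum s ≡ n → genSum p q inv coinv (R n s) ≈ multinomial s
  inv-GF n s e = begin
    genSum p q inv coinv (R n s)                                ≈⟨ genSum≈GF n s inv coinv ⟩
    GF n s inv coinv                                            ≈⟨ GF-cong n s inv≡letterStat coinv≡letterStat ⟩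
    GF n s (letterStat (λ _ → false)) (letterStat (λ _ → true)) ≈⟨ letterStat-GF n (λ _ → false) s e ⟩
    multinomial s                                               ∎

  theorem7 : ∀ {m} n (s : Vec ℕ m) → sum s ≡ n → (c : StatChoice n m) →
    (genSum p q (statA c) (statĀ c) (R n s) ≈ genSum p q inv coinv (R n s))
    × (genSum p q inv coinv (R n s) * pqFactProd p q s ≈ pqFact p q n)
  theorem7 n s e c =
    trans (genSum≈GF n s (statA c) (statĀ c)) (trans (statistic-GF n s e c) (sym (inv-GF n s e))) ,
    trans (*-congʳ (inv-GF n s e)) (trans (multinomial-factorials s) (reflexive (≡.cong (pqFact p q) e)))

mainTheorem7 : (m n : ℕ) → 1 ≤ m → 1 ≤ n → (s : Vec ℕ m) → sum s ≡ n →
    (c : StatChoice n m) → (Rg : CommutativeSemiring 0ℓ 0ℓ) →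
    let open CommutativeSemiring Rg
        open PQ Rg
    in (p q : Carrier) →
      (genSum p q (statA c) (statĀ c) (R n s) ≈ genSum p q inv coinv (R n s))
      × (genSum p q inv coinv (R n s) * pqFactProd p q s ≈ pqFact p q n)
mainTheorem7 _ n _ _ s e c Rg p q = GeneratingFunctions.theorem7 Rg p q n s e c
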